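{- Let $G$ be a connected stepwise irregular graph. Then the complement $\overline{G}$ of $G$ is not stepwise irregular.
   Context: All graphs are finite and simple. A graph $G$ is stepwise irregular (SI) if for every edge $uv\in E(G)$ one has $|d_G(u)-d_G(v)|=1$, where $d_G$ denotes degree; a disconnected graph is called SI if each of its connected components is SI. $\overline{G}$ has vertex set $V(G)$, with two distinct vertices adjacent iff they are not adjacent in $G$. -}

module Defs where

open import Data.Nat using (ℕ; suc; _+_)
open import Data.Fin using (Fin)
open import Data.Bool using (Bool; true; false; not)
open import Data.List using (filterᵇ; length; allFin)
open import Data.Product using (Σ; ∃; _×_)
open import Data.Sum using (_⊎_)
open import Data.List using (List; []; _∷_)
open import Relation.Binary.PropositionalEquality using (_≡_; _≢_)
open import Relation.Nullary using (¬_)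
open import Relation.Nullary.Decidable using (⌊_⌋)
open import Data.Fin using (_≟_)

record Graph (n : ℕ) : Set where
  field
    adj   : Fin n → Fin n → Bool
    sym   : ∀ u v → adj u v ≡ adj v u
    irrefl : ∀ v → adj v v ≡ false

open Graph public

Adj : ∀ {n} → Graph n → Fin n → Fin n → Set
Adj G u v = adj G u v ≡ true

degree : ∀ {n} → Graph n → Fin n → ℕ
degree G v = length (filterᵇ (adj G v) (allFin _))

complement : ∀ {n} → Graph n → Graph n
complement {n} G = record
  { adj = λ u v → if ⌊ u ≟ v ⌋ then false else not (adj G u v)
  ; sym = symC
  ; irrefl = irrC }
  where
  open import Data.Bool using (if_then_else_)
  open import Relation.Binary.PropositionalEquality using (refl; cong)
  open import Relation.Nullary using (yes; no)
  open import Data.Fin.Properties using () renaming (_≟_ to _≟F_)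
  symC : ∀ u v → (if ⌊ u ≟ v ⌋ then false else not (adj G u v))
               ≡ (if ⌊ v ≟ u ⌋ then false else not (adj G v u))
  symC u v with u ≟ v | v ≟ u
  ... | yes _ | yes _ = refl
  ... | yes refl | no q = Data.Empty.⊥-elim (q refl)
    where import Data.Empty
  ... | no p | yes refl = Data.Empty.⊥-elim (p refl)
    where import Data.Empty
  ... | no _ | no _ = cong not (Graph.sym G u v)
  irrC : ∀ v → (if ⌊ v ≟ v ⌋ then false else not (adj G v v)) ≡ false
  irrC v with v ≟ v
  ... | yes _ = refl
  ... | no p = Data.Empty.⊥-elim (p refl)
    where import Data.Empty

data Walk {n} (G : Graph n) : Fin n → Fin n → Set where
  here : ∀ {v} → Walk G v v
  step : ∀ {u w v} → Adj G u w → Walk G w v → Walk G u v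

Connected : ∀ {n} → Graph n → Set
Connected G = ∀ u v → Walk G u v

DiffOne : ℕ → ℕ → Set
DiffOne a b = (a ≡ suc b) ⊎ (b ≡ suc a)

-- stepwise irregular: every edge joins vertices whose degrees differ by exactly 1.
-- (For a disconnected graph the paper requires each component to be SI; since
-- the degree of a vertex in its component equals its degree in G and every edge
-- lies in a component, this is the same edgewise condition.)
StepwiseIrregular : ∀ {n} → Graph n → Set
StepwiseIrregular G = ∀ u v → Adj G u v → DiffOne (degree G u) (degree G v)

-- The complement of a stepwise irregular graph with an edge is not
-- stepwise irregular.
--
-- Write d and d̄ for the degrees in G and in its complement.  Two facts drive
-- the proof.
--   * d v + d̄ v + 1 = n for every vertex v, so degree differences are the same
--     in G and in its complement up to sign; hence if both G and its complement
--     are stepwise irregular, then EVERY pair of distinct vertices has degrees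
--     differing by exactly one (adjacent pairs via G, non-adjacent via the
--     complement).
--   * Along an edge ab with d a = d b + 1, the vertex a has degree at least 2
--     (since d b ≥ 1), so it has a neighbour w ≠ b.  Then d w = d a ± 1 is
--     d b or d b + 2, which contradicts |d b − d w| = 1.
-- The file first develops counting lemmas for Boolean filters over lists,
-- then the degree facts above, and finally the theorem.
module Submission where

open import Defs hiding (sym)
open import Data.Nat using (ℕ; zero; suc; pred; _+_; _≤_; z≤n; s≤s)
open import Data.Nat.Properties
  using (+-suc; +-cancelʳ-≡; +-cancelʳ-≤; +-mono-≤; ≤-trans; ≤-reflexive; m≤n+m; 1+n≢n; m≢1+n+m)
open import Data.Fin using (Fin; zero; suc; _≟_)
open import Data.Bool using (Bool; true; false; not; _∧_)
open import Data.List using (List; []; _∷_; filterᵇ; length; allFin; tabulate)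
open import Data.List.Properties using (length-tabulate)
open import Data.List.Relation.Unary.Any using (here; there)
open import Data.List.Membership.Propositional using (_∈_)
open import Data.List.Membership.Propositional.Properties using (∈-allFin)
open import Data.Product using (∃; ∃₂; _,_; _×_)
open import Data.Sum using (inj₁; inj₂)
open import Data.Empty using (⊥)
open import Function using (_∘_; id; case_of_)
open import Relation.Nullary using (¬_; yes; no; contradiction)
open import Relation.Nullary.Decidable using (⌊_⌋)
open import Relation.Binary.PropositionalEquality
open import Data.Nat.Tactic.RingSolver using (solve-∀)

count : {A : Set} → (A → Bool) → List A → ℕ
count p xs = length (filterᵇ p xs)

bit : Bool → ℕ
bit true  = 1
bit false = 0

count-cons : {A : Set} (p : A → Bool) (x : A) (xs : List A) → count p (x ∷ xs) ≡ bit (p x) + count p xs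
count-cons p x xs with p x
... | true  = refl
... | false = refl

count-ext : {A : Set} {p q : A → Bool} → (∀ x → p x ≡ q x) → (xs : List A) → count p xs ≡ count q xs
count-ext {p = p} {q} p≗q []       = refl
count-ext {p = p} {q} p≗q (x ∷ xs) = begin
  count p (x ∷ xs)           ≡⟨ count-cons p x xs ⟩
  bit (p x) + count p xs     ≡⟨ cong₂ _+_ (cong bit (p≗q x)) (count-ext p≗q xs) ⟩
  bit (q x) + count q xs     ≡⟨ sym (count-cons q x xs) ⟩
  count q (x ∷ xs)           ∎
  where open ≡-Reasoning

count-none : {A : Set} (xs : List A) → count (λ _ → false) xs ≡ 0
count-none []       = refl
count-none (x ∷ xs) = count-none xs

-- Counting over a tabulated list is counting the composite predicate over Fin n;
-- this is what lets us peel off the first vertex of allFin (suc n).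
count-tabulate : {A : Set} (n : ℕ) (p : A → Bool) (f : Fin n → A) →
                 count p (tabulate f) ≡ count (p ∘ f) (allFin n)
count-tabulate zero    p f = refl
count-tabulate (suc n) p f = begin
  count p (tabulate f)                              ≡⟨ count-cons p (f zero) (tabulate (f ∘ suc)) ⟩
  bit (p (f zero)) + count p (tabulate (f ∘ suc))   ≡⟨ cong (bit (p (f zero)) +_) (count-tabulate n p (f ∘ suc)) ⟩
  bit (p (f zero)) + count (p ∘ f ∘ suc) (allFin n) ≡⟨ cong (bit (p (f zero)) +_) (sym (count-tabulate n (p ∘ f) suc)) ⟩
  bit (p (f zero)) + count (p ∘ f) (tabulate suc)   ≡⟨ sym (count-cons (p ∘ f) zero (tabulate suc)) ⟩
  count (p ∘ f) (allFin (suc n))                    ∎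
  where open ≡-Reasoning

_==_ : ∀ {n} → Fin n → Fin n → Bool
v == x = ⌊ v ≟ x ⌋

suc-== : ∀ {n} (v x : Fin n) → (suc v == suc x) ≡ (v == x)
suc-== v x with v ≟ x
... | yes _ = refl
... | no  _ = refl

count-== : (n : ℕ) (v : Fin n) → count (v ==_) (allFin n) ≡ 1
count-== (suc n) zero    = cong suc (trans (count-tabulate n (zero ==_) suc) (count-none (allFin n)))
count-== (suc n) (suc v) = begin
  count (suc v ==_) (tabulate suc) ≡⟨ count-tabulate n (suc v ==_) suc ⟩
  count (suc v ==_ ∘ suc) (allFin n) ≡⟨ count-ext (suc-== v) (allFin n) ⟩
  count (v ==_) (allFin n)          ≡⟨ count-== n v ⟩
  1                                 ∎
  where open ≡-Reasoning

count-partition : {A : Set} (p q r : A → Bool) →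
                  (∀ x → bit (p x) + bit (q x) + bit (r x) ≡ 1) →
                  ∀ xs → count p xs + count q xs + count r xs ≡ length xs
count-partition p q r one []       = refl
count-partition p q r one (x ∷ xs) = begin
  count p (x ∷ xs) + count q (x ∷ xs) + count r (x ∷ xs)
    ≡⟨ cong₂ _+_ (cong₂ _+_ (count-cons p x xs) (count-cons q x xs)) (count-cons r x xs) ⟩
  (bit (p x) + count p xs) + (bit (q x) + count q xs) + (bit (r x) + count r xs)
    ≡⟨ regroup (bit (p x)) (bit (q x)) (bit (r x)) _ _ _ ⟩
  (bit (p x) + bit (q x) + bit (r x)) + (count p xs + count q xs + count r xs)
    ≡⟨ cong₂ _+_ (one x) (count-partition p q r one xs) ⟩
  suc (length xs) ∎
  where
  open ≡-Reasoning
  regroup : ∀ a b c d e f → (a + d) + (b + e) + (c + f) ≡ (a + b + c) + (d + e + f)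
  regroup = solve-∀

count-split : {A : Set} (p r : A → Bool) (xs : List A) →
              count p xs ≤ count (λ x → p x ∧ not (r x)) xs + count r xs
count-split p r []       = z≤n
count-split p r (x ∷ xs) = subst₂ _≤_ (sym (count-cons p x xs)) (sym split-cons)
  (≤-trans (+-mono-≤ (bit-split (p x) (r x)) (count-split p r xs))
           (≤-reflexive (regroup (bit (p x ∧ not (r x))) (bit (r x)) _ _)))
  where
  pr : _ → Bool
  pr x = p x ∧ not (r x)
  bit-split : ∀ a b → bit a ≤ bit (a ∧ not b) + bit b
  bit-split true  true  = s≤s z≤n
  bit-split true  false = s≤s z≤n
  bit-split false b     = z≤n
  split-cons : count pr (x ∷ xs) + count r (x ∷ xs) ≡ (bit (pr x) + count pr xs) + (bit (r x) + count r xs)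
  split-cons = cong₂ _+_ (count-cons pr x xs) (count-cons r x xs)
  regroup : ∀ a b c d → (a + b) + (c + d) ≡ (a + c) + (b + d)
  regroup = solve-∀

count-positive : {A : Set} (p : A → Bool) {x : A} {xs : List A} → x ∈ xs → p x ≡ true → 1 ≤ count p xs
count-positive p {xs = y ∷ xs} (here refl) px rewrite count-cons p y xs | px = s≤s z≤n
count-positive p {xs = y ∷ xs} (there x∈xs) px rewrite count-cons p y xs =
  ≤-trans (count-positive p x∈xs px) (m≤n+m (count p xs) (bit (p y)))

count-witness : {A : Set} (p : A → Bool) (xs : List A) → 1 ≤ count p xs → ∃ λ x → p x ≡ true
count-witness p (x ∷ xs) pos with p x in px
... | true  = x , px
... | false = count-witness p xs pos

adjacency-trichotomy : ∀ {n} (G : Graph n) v x →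
  bit (adj G v x) + bit (adj (complement G) v x) + bit (v == x) ≡ 1
adjacency-trichotomy G v x with v ≟ x
... | yes refl rewrite irrefl G v = refl
... | no  _ with adj G v x
...   | true  = refl
...   | false = refl

length-allFin : ∀ n → length (allFin n) ≡ n
length-allFin n = length-tabulate id

degree-complement : ∀ {n} (G : Graph n) v → degree G v + degree (complement G) v + 1 ≡ n
degree-complement {n} G v = begin
  degree G v + degree (complement G) v + 1
    ≡⟨ cong (degree G v + degree (complement G) v +_) (sym (count-== n v)) ⟩
  degree G v + degree (complement G) v + count (v ==_) (allFin n)
    ≡⟨ count-partition (adj G v) (adj (complement G) v) (v ==_) (adjacency-trichotomy G v) (allFin n) ⟩
  length (allFin n)
    ≡⟨ length-allFin n ⟩
  n ∎
  where open ≡-Reasoning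

DiffOne-balanced : ∀ {a b c e} → a + c ≡ b + e → DiffOne c e → DiffOne a b
DiffOne-balanced {a} {b} {c} {e} sum (inj₁ refl) = inj₂ (+-cancelʳ-≡ e b (suc a) (trans (sym sum) (+-suc a e)))
DiffOne-balanced {a} {b} {c} {e} sum (inj₂ refl) = inj₁ (+-cancelʳ-≡ c a (suc b) (trans sum (+-suc b c)))

complement-DiffOne : ∀ {n} (G : Graph n) u w →
  DiffOne (degree (complement G) u) (degree (complement G) w) → DiffOne (degree G u) (degree G w)
complement-DiffOne G u w = DiffOne-balanced
  (+-cancelʳ-≡ _ _ _ (trans (degree-complement G u) (sym (degree-complement G w))))

distinct-DiffOne : ∀ {n} (G : Graph n) → StepwiseIrregular G → StepwiseIrregular (complement G) →
  ∀ u w → u ≢ w → DiffOne (degree G u) (degree G w)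
distinct-DiffOne G si si̅ u w u≢w with adj G u w in uw
... | true  = si u w uw
... | false = complement-DiffOne G u w (si̅ u w complement-adj)
  where
  complement-adj : Adj (complement G) u w
  complement-adj with u ≟ w
  ... | yes u≡w = contradiction u≡w u≢w
  ... | no  _ rewrite uw = refl

adjacent-degree : ∀ {n} (G : Graph n) {u v} → Adj G u v → 1 ≤ degree G u
adjacent-degree G {u} {v} uv = count-positive (adj G u) (∈-allFin v) uv

other-neighbour : ∀ {n} (G : Graph n) a b → 2 ≤ degree G a → ∃ λ w → Adj G a w × b ≢ w
other-neighbour {n} G a b deg≥2 with count-witness avoid-b (allFin n) avoid-b-positive
  where
  avoid-b : Fin n → Bool
  avoid-b x = adj G a x ∧ not (b == x)
  avoid-b-positive : 1 ≤ count avoid-b (allFin n)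
  avoid-b-positive = +-cancelʳ-≤ 1 1 _
    (subst (λ k → 2 ≤ count avoid-b (allFin n) + k) (count-== n b)
      (≤-trans deg≥2 (count-split (adj G a) (b ==_) (allFin n))))
... | w , aw∧b≠w = w , ∧-true₁ aw∧b≠w , distinct (∧-true₂ aw∧b≠w)
  where
  ∧-true₁ : ∀ {x y} → (x ∧ y) ≡ true → x ≡ true
  ∧-true₁ {true} _ = refl
  ∧-true₂ : ∀ {x y} → (x ∧ y) ≡ true → y ≡ true
  ∧-true₂ {true} y = y
  distinct : not (b == w) ≡ true → b ≢ w
  distinct b≠w refl with b ≟ b
  ... | yes _ = case b≠w of λ ()
  ... | no b≢b = b≢b refl

no-two-DiffOne : ∀ {x y} → DiffOne (suc x) y → DiffOne x y → ⊥
no-two-DiffOne (inj₁ refl) (inj₁ e) = 1+n≢n (sym e)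
no-two-DiffOne (inj₁ refl) (inj₂ e) = 1+n≢n (sym e)
no-two-DiffOne {x} (inj₂ refl) (inj₁ e) = m≢1+n+m x e
no-two-DiffOne (inj₂ refl) (inj₂ e) = 1+n≢n (cong pred e)

no-ascending-edge : ∀ {n} (G : Graph n) → StepwiseIrregular G → StepwiseIrregular (complement G) →
  ∀ a b → Adj G a b → degree G a ≡ suc (degree G b) → ⊥
no-ascending-edge G si si̅ a b ab da≡1+db with other-neighbour G a b a-has-two
  where
  a-has-two : 2 ≤ degree G a
  a-has-two = subst (2 ≤_) (sym da≡1+db) (s≤s (adjacent-degree G (trans (Graph.sym G b a) ab)))
... | w , aw , b≢w = no-two-DiffOne (subst (λ d → DiffOne d (degree G w)) da≡1+db (si a w aw))
                                    (distinct-DiffOne G si si̅ b w b≢w)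

mainTheorem14 : ∀ {n} (G : Graph n) → Connected G → (∃₂ λ u v → Adj G u v) →
    StepwiseIrregular G → ¬ StepwiseIrregular (complement G)
mainTheorem14 G _ (u , v , uv) si si̅ with si u v uv
... | inj₁ du≡1+dv = no-ascending-edge G si si̅ u v uv du≡1+dv
... | inj₂ dv≡1+du = no-ascending-edge G si si̅ v u (trans (Graph.sym G v u) uv) dv≡1+du
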